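{- Let $a\ge2$ be an integer. The subtraction game $\mathcal{S}(a,2a+1,3a+2)$ is periodic with period $4a+2$ and nim-sequence $0^a1^a\,0\,2^{a-1}\,1\,0\,3^{a-2}\,2\,1$. Moreover, the subtraction set is non-expandable.
   Context: For a finite set $S$ of positive integers, the subtraction game $\mathcal{S}(S)$ is played on a single pile: two players alternately remove $s\in S$ coins (at most the pile size); the last mover wins. The nim-value is $\mathcal{G}(n)=\operatorname{mex}\{\mathcal{G}(n-s): s\in S, s\le n\}$. Words of single digits are written by juxtaposition, and $x^m$ denotes $m$-fold repetition of the block $x$ ($x^0$ empty). "The game is periodic with period $p$ and nim-sequence $W$" ($W$ a word of length $p$) means $\mathcal{G}(n+p)=\mathcal{G}(n)$ for all $n\ge0$, $p$ is the least such, and $\mathcal{G}(n)$ is the $((n\bmod p)+1)$-st letter of $W$ for all $n\ge0$. The expansion of $S$ is $S^{ex}=\{s\ge1:\mathcal{G}(n+s)\ne\mathcal{G}(n)\ \forall n\ge0\}$. For a set $X$ and $p\ge1$, $X^{*p}=\{x+mp:x\in X,m\ge0\}$. $S$ is non-expandable if $S^{ex}=S$ or $S^{ex}=S^{*p}$, $p$ the period. -}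

module Defs where

open import Data.Nat using (ℕ; zero; suc; _+_; _*_; _∸_; _≤_; _<_; _≟_; NonZero)
open import Data.Nat.DivMod using (_%_)
open import Data.List using (List; []; _∷_; length; replicate; _++_)
open import Data.List.Membership.Propositional using (_∈_)
open import Data.List.Relation.Unary.Any using (any?)
open import Data.Maybe using (Maybe; just; nothing)
open import Data.Bool using (if_then_else_)
open import Data.Product using (_×_; ∃; ∃-syntax)
open import Data.Sum using (_⊎_)
open import Relation.Nullary using (¬_; does)
open import Relation.Binary.PropositionalEquality using (_≡_; _≢_)
open import Function.Bundles using (_⇔_)

-- A finite subtraction set is given as a list of positive integers.

nth : {A : Set} → List A → ℕ → Maybe A
nth []       _       = nothing
nth (x ∷ xs) zero    = just x
nth (x ∷ xs) (suc k) = nth xs k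

-- Indexing with default 0 (only used at valid indices below).
at : List ℕ → ℕ → ℕ
at []       _       = 0
at (x ∷ xs) zero    = x
at (x ∷ xs) (suc k) = at xs k

-- mex: least natural number not occurring in the list.
-- The search from m with fuel (length xs) suffices, since mex xs ≤ length xs.
mexFrom : ℕ → ℕ → List ℕ → ℕ
mexFrom m zero    xs = m
mexFrom m (suc f) xs = if does (any? (m ≟_) xs) then mexFrom (suc m) f xs else m

mex : List ℕ → ℕ
mex xs = mexFrom 0 (length xs) xs

-- Given prev = [G(n-1), G(n-2), ..., G(0)] (so G(n-s) = at prev (s-1)),
-- the options of position n: G(n-s) for s ∈ S with 1 ≤ s ≤ n.
options : List ℕ → ℕ → List ℕ → List ℕ
options []       n prev = []
options (s ∷ S)  n prev with s
... | zero  = options S n prev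
... | suc t = if does (suc t Data.Nat.≤? n)
                then at prev t ∷ options S n prev
                else options S n prev

-- prefix S n = [G(n-1), ..., G(0)]
prefix : List ℕ → ℕ → List ℕ
prefix S zero    = []
prefix S (suc n) = mex (options S n (prefix S n)) ∷ prefix S n

G : List ℕ → ℕ → ℕ
G S n = mex (options S n (prefix S n))

record PeriodicWith (S : List ℕ) (p : ℕ) .{{_ : NonZero p}} (W : List ℕ) : Set where
  field
    period    : ∀ n → G S (n + p) ≡ G S n
    least     : ∀ q → 1 ≤ q → (∀ n → G S (n + q) ≡ G S n) → p ≤ q
    wordLen   : length W ≡ p
    wordValue : ∀ n → nth W (n % p) ≡ just (G S n)

InExpansion : List ℕ → ℕ → Set
InExpansion S s = 1 ≤ s × (∀ n → G S (n + s) ≢ G S n)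

InStar : List ℕ → ℕ → ℕ → Set
InStar X p s = ∃[ x ] ∃[ m ] (x ∈ X × s ≡ x + m * p)

NonExpandable : List ℕ → ℕ → Set
NonExpandable S p =
  (∀ s → InExpansion S s ⇔ s ∈ S) ⊎ (∀ s → InExpansion S s ⇔ InStar S p s)

word : ℕ → List ℕ
word a = replicate a 0 ++ replicate a 1 ++ (0 ∷ []) ++ replicate (a ∸ 1) 2
         ++ (1 ∷ 0 ∷ []) ++ replicate (a ∸ 2) 3 ++ (2 ∷ 1 ∷ [])

module Submission where

-- Write a = 2 + b and let h n be the letter of this word at n mod p.  Rather than
-- computing G we check that h satisfies the defining recurrence
-- h n = mex {h (n - s) : s ∈ S, s ≤ n}; its solution is unique (G-unique), so G = h.
-- For n ≥ 3a + 2 all moves exist and, by periodicity, the recurrence only depends on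
-- the residue n mod p, read cyclically; below 3a + 2 it is checked directly.  Both
-- checks, the minimality of p and the expansion go through a classification of the
-- residues into fourteen kinds (Residue).  Positions are written linearly in b,
-- pos c d k = c·b + d + k, so that adding a move size or a period to a position is
-- computed by Agda on the numeral coefficients.

open import Defs
open import Data.Nat using (ℕ; _+_; _*_; _≤_)
open import Data.List using (_∷_; [])
open import Data.Product using (_×_)
open import Data.Nat using (zero; suc; _∸_; _<_; _≤?_; _<?_; _≟_; z≤n; s≤s)
open import Data.Nat.Properties
open import Data.Nat.DivMod using (_%_; _/_; [m+n]%n≡m%n; [m+kn]%n≡m%n; m%n%n≡m%n; m<n⇒m%n≡m; m%n<n; m≡m%n+[m/n]*n)
open import Data.Nat.Induction using (<-rec)
open import Data.Nat.Tactic.RingSolver using (solve-∀)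
open import Data.List using (List; length; replicate; _++_)
open import Data.List.Properties using (length-++; length-replicate)
open import Data.List.Membership.Propositional using (_∈_; _∉_)
open import Data.List.Relation.Unary.Any using (here; there; any?)
open import Data.Bool using (if_then_else_)
open import Data.Maybe using (just)
open import Data.Product using (_,_; ∃-syntax)
open import Data.Sum using (_⊎_; inj₁; inj₂)
open import Data.Empty using (⊥-elim)
open import Function.Bundles using (_⇔_; mk⇔)
open import Relation.Nullary using (Dec; yes; no; does; ¬_; contradiction)
open import Relation.Binary.PropositionalEquality
open ≡-Reasoning

if-does : ∀ {P A : Set} (d : Dec P) {x y : A} (C : A → Set) →
          (P → C x) → (¬ P → C y) → C (if does d then x else y)
if-does (yes p) C then-case else-case = then-case p
if-does (no ¬p) C then-case else-case = else-case ¬p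

if-yes : ∀ {P A : Set} (d : Dec P) {x y : A} → P → (if does d then x else y) ≡ x
if-yes d {x} hold = if-does d (_≡ x) (λ _ → refl) (λ fail → contradiction hold fail)

if-no : ∀ {P A : Set} (d : Dec P) {x y : A} → ¬ P → (if does d then x else y) ≡ y
if-no d {y = y} fail = if-does d (_≡ y) (λ hold → contradiction hold fail) (λ _ → refl)

if-cong : ∀ {P A : Set} (d : Dec P) {x y x′ y′ : A} → (P → x ≡ x′) → (¬ P → y ≡ y′) →
          (if does d then x else y) ≡ (if does d then x′ else y′)
if-cong (yes p) then-eq else-eq = then-eq p
if-cong (no ¬p) then-eq else-eq = else-eq ¬p

atLeast : ℕ → List ℕ → ℕ
atLeast m []       = 0
atLeast m (x ∷ xs) = if does (m ≤? x) then suc (atLeast m xs) else atLeast m xs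

atLeast-≤-length : ∀ m xs → atLeast m xs ≤ length xs
atLeast-≤-length m []       = z≤n
atLeast-≤-length m (x ∷ xs) =
  if-does (m ≤? x) (_≤ length (x ∷ xs))
    (λ _ → s≤s (atLeast-≤-length m xs)) (λ _ → m≤n⇒m≤1+n (atLeast-≤-length m xs))

atLeast-suc-≤ : ∀ m xs → atLeast (suc m) xs ≤ atLeast m xs
atLeast-suc-≤ m []       = z≤n
atLeast-suc-≤ m (x ∷ xs) =
  if-does (suc m ≤? x) (_≤ atLeast m (x ∷ xs))
    (λ m<x → if-does (m ≤? x) (suc (atLeast (suc m) xs) ≤_)
               (λ _ → s≤s (atLeast-suc-≤ m xs)) (λ m≰x → contradiction (<⇒≤ m<x) m≰x))
    (λ _ → if-does (m ≤? x) (atLeast (suc m) xs ≤_)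
             (λ _ → m≤n⇒m≤1+n (atLeast-suc-≤ m xs)) (λ _ → atLeast-suc-≤ m xs))

atLeast-suc-< : ∀ {m xs} → m ∈ xs → atLeast (suc m) xs < atLeast m xs
atLeast-suc-< {m} {_ ∷ xs} (here refl) =
  if-does (suc m ≤? m) (_< atLeast m (m ∷ xs))
    (λ m<m → contradiction m<m (n≮n m))
    (λ _ → if-does (m ≤? m) (atLeast (suc m) xs <_)
             (λ _ → s≤s (atLeast-suc-≤ m xs)) (λ m≰m → contradiction ≤-refl m≰m))
atLeast-suc-< {m} {x ∷ xs} (there m∈xs) =
  if-does (suc m ≤? x) (_< atLeast m (x ∷ xs))
    (λ m<x → if-does (m ≤? x) (suc (atLeast (suc m) xs) <_)
               (λ _ → s≤s (atLeast-suc-< m∈xs)) (λ m≰x → contradiction (<⇒≤ m<x) m≰x))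
    (λ _ → if-does (m ≤? x) (atLeast (suc m) xs <_)
             (λ _ → m<n⇒m<1+n (atLeast-suc-< m∈xs)) (λ _ → atLeast-suc-< m∈xs))

-- The search for the mex starting at m never returns a member as long as the fuel
-- covers the entries ≥ m: each successful membership test uses up one of them.
mexFrom-∉ : ∀ m f xs → atLeast m xs ≤ f → mexFrom m f xs ∉ xs
mexFrom-∉ m zero    xs bound m∈xs = n≮0 (<-≤-trans (atLeast-suc-< m∈xs) bound)
mexFrom-∉ m (suc f) xs bound =
  if-does (any? (m ≟_) xs) (_∉ xs)
    (λ m∈xs → mexFrom-∉ (suc m) f xs (≤-pred (≤-trans (atLeast-suc-< m∈xs) bound)))
    (λ m∉xs → m∉xs)

mex-∉ : ∀ xs → mex xs ∉ xs
mex-∉ xs = mexFrom-∉ 0 (length xs) xs (atLeast-≤-length 0 xs)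

moves : (ℕ → ℕ) → List ℕ → ℕ → List ℕ
moves h []          n = []
moves h (zero  ∷ T) n = moves h T n
moves h (suc t ∷ T) n = if does (suc t ≤? n) then h (n ∸ suc t) ∷ moves h T n else moves h T n

at-prefix : ∀ S n t → t < n → at (prefix S n) t ≡ G S (n ∸ suc t)
at-prefix S (suc n) zero    _         = refl
at-prefix S (suc n) (suc t) (s≤s t<n) = at-prefix S n t t<n

options-prefix : ∀ S n T → options T n (prefix S n) ≡ moves (G S) T n
options-prefix S n []          = refl
options-prefix S n (zero  ∷ T) = options-prefix S n T
options-prefix S n (suc t ∷ T) =
  if-cong (suc t ≤? n) (λ t<n → cong₂ _∷_ (at-prefix S n t t<n) (options-prefix S n T))
                       (λ _ → options-prefix S n T)

G-moves : ∀ S n → G S n ≡ mex (moves (G S) S n)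
G-moves S n = cong mex (options-prefix S n S)

moves-cong : ∀ {f g : ℕ → ℕ} T n → (∀ {m} → m < n → f m ≡ g m) → moves f T n ≡ moves g T n
moves-cong []          n f≡g = refl
moves-cong (zero  ∷ T) n f≡g = moves-cong T n f≡g
moves-cong (suc t ∷ T) n f≡g =
  if-cong (suc t ≤? n) (λ t<n → cong₂ _∷_ (f≡g (∸-monoʳ-< (s≤s z≤n) t<n)) (moves-cong T n f≡g))
                       (λ _ → moves-cong T n f≡g)

G-unique : ∀ S (h : ℕ → ℕ) → (∀ n → h n ≡ mex (moves h S n)) → ∀ n → G S n ≡ h n
G-unique S h rec = <-rec (λ n → G S n ≡ h n) step
  where
  step : ∀ n → (∀ {m} → m < n → G S m ≡ h m) → G S n ≡ h n
  step n ih = trans (G-moves S n) (trans (cong mex (moves-cong S n ih)) (sym (rec n)))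

moves-∈ : ∀ (f : ℕ → ℕ) {t n} T → suc t ∈ T → suc t ≤ n → f (n ∸ suc t) ∈ moves f T n
moves-∈ f {t} {n} (_ ∷ T) (here refl) t<n =
  if-does (suc t ≤? n) (f (n ∸ suc t) ∈_) (λ _ → here refl) (λ t≮n → contradiction t<n t≮n)
moves-∈ f (zero  ∷ T) (there t∈T) t<n = moves-∈ f T t∈T t<n
moves-∈ f {t} {n} (suc u ∷ T) (there t∈T) t<n =
  if-does (suc u ≤? n) (f (n ∸ suc t) ∈_)
    (λ _ → there (moves-∈ f T t∈T t<n)) (λ _ → moves-∈ f T t∈T t<n)

-- S ⊆ S^ex: a move changes the nim-value, since G n is an option of G (n + s).
move-changes-G : ∀ S {s} → s ∈ S → 1 ≤ s → ∀ n → G S (n + s) ≢ G S n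
move-changes-G S {suc t} s∈S _ n same = mex-∉ (moves (G S) S m) mex∈moves
  where
  m = n + suc t
  G-n∈moves : G S n ∈ moves (G S) S m
  G-n∈moves = subst (λ x → G S x ∈ moves (G S) S m) (m+n∸n≡m n (suc t))
                    (moves-∈ (G S) S s∈S (m≤n+m (suc t) n))
  mex∈moves : mex (moves (G S) S m) ∈ moves (G S) S m
  mex∈moves = subst (_∈ moves (G S) S m) (sym (trans (sym (G-moves S m)) same)) G-n∈moves

le-sum : ∀ x y {n} → x + y ≡ n → x ≤ n
le-sum x y refl = m≤m+n x y

minus-sum : ∀ x y {n} → x + y ≡ n → n ∸ x ≡ y
minus-sum x y refl = m+n∸m≡n x y

shift-past-period : ∀ n x p y → n + (x + (p + y)) ≡ n + (x + y) + p
shift-past-period = solve-∀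

periodic-shift : ∀ (f : ℕ → ℕ) p → (∀ n → f (n + p) ≡ f n) →
                 ∀ n x m → f (n + (x + m * p)) ≡ f (n + x)
periodic-shift f p per n x zero    = cong (λ y → f (n + y)) (+-identityʳ x)
periodic-shift f p per n x (suc m) = begin
  f (n + (x + (p + m * p))) ≡⟨ cong f (shift-past-period n x p (m * p)) ⟩
  f (n + (x + m * p) + p)   ≡⟨ per (n + (x + m * p)) ⟩
  f (n + (x + m * p))       ≡⟨ periodic-shift f p per n x m ⟩
  f (n + x)                 ∎

nth-replicate-skip : ∀ m (c : ℕ) ys j → nth (replicate m c ++ ys) (m + j) ≡ nth ys j
nth-replicate-skip zero    c ys j = refl
nth-replicate-skip (suc m) c ys j = nth-replicate-skip m c ys j

nth-replicate-hit : ∀ m (c : ℕ) ys {j} → j < m → nth (replicate m c ++ ys) j ≡ just c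
nth-replicate-hit (suc m) c ys {zero}  _         = refl
nth-replicate-hit (suc m) c ys {suc j} (s≤s j<m) = nth-replicate-hit m c ys j<m

nth-just-< : ∀ (xs : List ℕ) {j v} → nth xs j ≡ just v → j < length xs
nth-just-< (x ∷ xs) {zero}  _  = s≤s z≤n
nth-just-< (x ∷ xs) {suc j} eq = s≤s (nth-just-< xs eq)

nth-just-at : ∀ (xs : List ℕ) {j v} → nth xs j ≡ just v → at xs j ≡ v
nth-just-at (x ∷ xs) {zero}  refl = refl
nth-just-at (x ∷ xs) {suc j} eq   = nth-just-at xs eq

nth-at : ∀ (xs : List ℕ) {j} → j < length xs → nth xs j ≡ just (at xs j)
nth-at (x ∷ xs) {zero}  _         = refl
nth-at (x ∷ xs) {suc j} (s≤s j<n) = nth-at xs j<n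

length-replicate-++ : ∀ m (c : ℕ) ys → length (replicate m c ++ ys) ≡ m + length ys
length-replicate-++ m c ys = trans (length-++ (replicate m c)) (cong (_+ length ys) (length-replicate m))

-- Positions in the period are written c·b + d + k (with a = 2 + b);
-- the first group says how such forms combine, the second locates the move sizes and
-- the period, the third matches forms with the run structure of the word.

pos-add-shape : ∀ b c d c′ d′ k → (c * b + d + 0) + (c′ * b + d′ + k) ≡ (c + c′) * b + (d + d′) + k
pos-add-shape = solve-∀

pos-suc-shape : ∀ b c d k → c * b + d + suc k ≡ c * b + suc d + k
pos-suc-shape = solve-∀

pos-next-shape : ∀ b c d → suc (c * b + d + 0) ≡ c * b + suc d + 0
pos-next-shape = solve-∀

pos-run-shape : ∀ b c d k → (c * b + d + 0) + k ≡ c * b + d + k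
pos-run-shape = solve-∀

pos-skip-shape : ∀ b c d → (c * b + d + 0) + b ≡ suc c * b + d + 0
pos-skip-shape = solve-∀

next-row-shape : ∀ b c d e → c * b + d + b + suc e ≡ suc c * b + suc (d + e) + 0
next-row-shape = solve-∀

a-shape : ∀ b → 2 + b ≡ 1 * b + 2 + 0
a-shape = solve-∀

2a+1-shape : ∀ b → 2 * (2 + b) + 1 ≡ 2 * b + 5 + 0
2a+1-shape = solve-∀

3a+2-shape : ∀ b → 3 * (2 + b) + 2 ≡ 3 * b + 8 + 0
3a+2-shape = solve-∀

p-shape : ∀ b → 2 + 4 * (2 + b) ≡ 4 * b + 10 + 0
p-shape = solve-∀

4a-shape : ∀ b → 4 * b + 8 + 0 ≡ 3 * (2 + b) + 2 + b
4a-shape = solve-∀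

a+[3a+2] : ∀ a → a + (3 * a + 2) ≡ 2 + 4 * a
a+[3a+2] = solve-∀

[2a+1]+[2a+1] : ∀ a → (2 * a + 1) + (2 * a + 1) ≡ 2 + 4 * a
[2a+1]+[2a+1] = solve-∀

[3a+2]+a : ∀ a → (3 * a + 2) + a ≡ 2 + 4 * a
[3a+2]+a = solve-∀

word-length-shape : ∀ b → (2 + b) + ((2 + b) + suc ((1 + b) + suc (suc (b + 2)))) ≡ 2 + 4 * (2 + b)
word-length-shape = solve-∀

a-2-shape : ∀ b → 1 * b + 0 + 0 ≡ b
a-2-shape = solve-∀

a-1-shape : ∀ b → 1 * b + 1 + 0 ≡ 1 + b
a-1-shape = solve-∀

ones-shape : ∀ b e k → 1 * b + (2 + e) + k ≡ (2 + b) + (e + k)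
ones-shape = solve-∀

2a-2-shape : ∀ b → 2 * b + 2 + 0 ≡ (2 + b) + b
2a-2-shape = solve-∀

2a-1-shape : ∀ b → 2 * b + 3 + 0 ≡ (2 + b) + (1 + b)
2a-1-shape = solve-∀

2a-shape : ∀ b → 2 * b + 4 + 0 ≡ (2 + b) + ((2 + b) + 0)
2a-shape = solve-∀

twos-shape : ∀ b e k → 2 * b + (5 + e) + k ≡ (2 + b) + ((2 + b) + (1 + (e + k)))
twos-shape = solve-∀

3a-1-shape : ∀ b → 3 * b + 5 + 0 ≡ (2 + b) + ((2 + b) + (1 + b))
3a-1-shape = solve-∀

3a-shape : ∀ b → 3 * b + 6 + 0 ≡ (2 + b) + ((2 + b) + (1 + ((1 + b) + 0)))
3a-shape = solve-∀

3a+1-shape : ∀ b → 3 * b + 7 + 0 ≡ (2 + b) + ((2 + b) + (1 + ((1 + b) + 1)))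
3a+1-shape = solve-∀

threes-shape : ∀ b k → 3 * b + 8 + k ≡ (2 + b) + ((2 + b) + (1 + ((1 + b) + (2 + k))))
threes-shape = solve-∀

4a-word-shape : ∀ b → 4 * b + 8 + 0 ≡ (2 + b) + ((2 + b) + (1 + ((1 + b) + (2 + (b + 0)))))
4a-word-shape = solve-∀

4a+1-shape : ∀ b → 4 * b + 9 + 0 ≡ (2 + b) + ((2 + b) + (1 + ((1 + b) + (2 + (b + 1)))))
4a+1-shape = solve-∀

module Game (b : ℕ) where

  a p : ℕ
  a = 2 + b
  p = 2 + 4 * a

  S : List ℕ
  S = a ∷ (2 * a + 1) ∷ (3 * a + 2) ∷ []

  h : ℕ → ℕ
  h n = at (word a) (n % p)

  pos : ℕ → ℕ → ℕ → ℕ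
  pos c d k = c * b + d + k

  pos-add : ∀ c d c′ d′ k → pos c d 0 + pos c′ d′ k ≡ pos (c + c′) (d + d′) k
  pos-add = pos-add-shape b

  shift : ∀ {x} c d {c′ d′ k} → x ≡ pos c d 0 → x + pos c′ d′ k ≡ pos (c + c′) (d + d′) k
  shift c d {c′} {d′} {k} x≡ = trans (cong (_+ pos c′ d′ k) x≡) (pos-add c d c′ d′ k)

  h-periodic : ∀ n → h (n + p) ≡ h n
  h-periodic n = cong (at (word a)) ([m+n]%n≡m%n n p)

  h-multiple : ∀ x m → h (x + m * p) ≡ h x
  h-multiple x m = cong (at (word a)) ([m+kn]%n≡m%n x m p)

  h-mod : ∀ n → h (n % p) ≡ h n
  h-mod n = cong (at (word a)) (m%n%n≡m%n n p)

  length-word : length (word a) ≡ p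
  length-word = begin
    length (word a)
      ≡⟨ length-replicate-++ a 0 _ ⟩
    a + length (replicate a 1 ++ 0 ∷ replicate (1 + b) 2 ++ 1 ∷ 0 ∷ replicate b 3 ++ 2 ∷ 1 ∷ [])
      ≡⟨ cong (a +_) (length-replicate-++ a 1 _) ⟩
    a + (a + suc (length (replicate (1 + b) 2 ++ 1 ∷ 0 ∷ replicate b 3 ++ 2 ∷ 1 ∷ [])))
      ≡⟨ cong (λ l → a + (a + suc l)) (length-replicate-++ (1 + b) 2 _) ⟩
    a + (a + suc ((1 + b) + suc (suc (length (replicate b 3 ++ 2 ∷ 1 ∷ [])))))
      ≡⟨ cong (λ l → a + (a + suc ((1 + b) + suc (suc l)))) (length-replicate-++ b 3 _) ⟩
    a + (a + suc ((1 + b) + suc (suc (b + 2))))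
      ≡⟨ word-length-shape b ⟩
    p ∎

  h-at : ∀ {x y v} → x ≡ y → nth (word a) y ≡ just v → h x ≡ v
  h-at {x} refl found = begin
    at (word a) (x % p) ≡⟨ cong (at (word a)) (m<n⇒m%n≡m x<p) ⟩
    at (word a) x       ≡⟨ nth-just-at (word a) {x} found ⟩
    _                   ∎
    where
    x<p : x < p
    x<p = subst (x <_) length-word (nth-just-< (word a) found)

  nth-zeros : ∀ {j} → j < a → nth (word a) j ≡ just 0
  nth-zeros = nth-replicate-hit a 0 _

  nth-ones : ∀ {j} → j < a → nth (word a) (a + j) ≡ just 1
  nth-ones {j} j<a = trans (nth-replicate-skip a 0 _ j) (nth-replicate-hit a 1 _ j<a)

  after-ones : ∀ j → nth (word a) (a + (a + j))
                   ≡ nth (0 ∷ replicate (1 + b) 2 ++ 1 ∷ 0 ∷ replicate b 3 ++ 2 ∷ 1 ∷ []) j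
  after-ones j = trans (nth-replicate-skip a 0 _ (a + j)) (nth-replicate-skip a 1 _ j)

  nth-twos : ∀ {j} → j < 1 + b → nth (word a) (a + (a + (1 + j))) ≡ just 2
  nth-twos {j} j<a-1 = trans (after-ones (1 + j)) (nth-replicate-hit (1 + b) 2 _ j<a-1)

  after-twos : ∀ j → nth (word a) (a + (a + (1 + ((1 + b) + j))))
                   ≡ nth (1 ∷ 0 ∷ replicate b 3 ++ 2 ∷ 1 ∷ []) j
  after-twos j = trans (after-ones (1 + ((1 + b) + j))) (nth-replicate-skip (1 + b) 2 _ j)

  nth-threes : ∀ {j} → j < b → nth (word a) (a + (a + (1 + ((1 + b) + (2 + j))))) ≡ just 3
  nth-threes {j} j<a-2 = trans (after-twos (2 + j)) (nth-replicate-hit b 3 _ j<a-2)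

  after-threes : ∀ j → nth (word a) (a + (a + (1 + ((1 + b) + (2 + (b + j)))))) ≡ nth (2 ∷ 1 ∷ []) j
  after-threes j = trans (after-twos (2 + (b + j))) (nth-replicate-skip b 3 _ j)

  zeros : ∀ e k → e + k < a → h (pos 0 e k) ≡ 0
  zeros e k lt = h-at {e + k} refl (nth-zeros lt)

  ones : ∀ e k → e + k < a → h (pos 1 (2 + e) k) ≡ 1
  ones e k lt = h-at (ones-shape b e k) (nth-ones lt)

  twos : ∀ e k → e + k < 1 + b → h (pos 2 (5 + e) k) ≡ 2
  twos e k lt = h-at (twos-shape b e k) (nth-twos lt)

  k<a : ∀ {k} → k < b → k < a
  k<a k<b = ≤-trans k<b (m≤n+m b 2)

  at-0 : h 0 ≡ 0
  at-0 = zeros 0 0 (s≤s z≤n)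

  at-k : ∀ {k} → k < b → h (pos 0 0 k) ≡ 0
  at-k {k} k<b = zeros 0 k (k<a k<b)

  at-1+k : ∀ {k} → k < b → h (pos 0 1 k) ≡ 0
  at-1+k {k} k<b = zeros 1 k (s≤s (m<n⇒m<1+n k<b))

  at-a-2 : h (pos 1 0 0) ≡ 0
  at-a-2 = h-at (a-2-shape b) (nth-zeros (m≤n⇒m≤1+n ≤-refl))

  at-a-1 : h (pos 1 1 0) ≡ 0
  at-a-1 = h-at (a-1-shape b) (nth-zeros ≤-refl)

  at-a : h (pos 1 2 0) ≡ 1
  at-a = ones 0 0 (s≤s z≤n)

  at-a+1 : h (pos 1 3 0) ≡ 1
  at-a+1 = ones 1 0 (s≤s (s≤s z≤n))

  at-a+k : ∀ {k} → k < b → h (pos 1 2 k) ≡ 1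
  at-a+k {k} k<b = ones 0 k (k<a k<b)

  at-a+1+k : ∀ {k} → k < b → h (pos 1 3 k) ≡ 1
  at-a+1+k {k} k<b = ones 1 k (s≤s (m<n⇒m<1+n k<b))

  at-a+2+k : ∀ {k} → k < b → h (pos 1 4 k) ≡ 1
  at-a+2+k {k} k<b = ones 2 k (s≤s (s≤s k<b))

  at-2a-2 : h (pos 2 2 0) ≡ 1
  at-2a-2 = h-at (2a-2-shape b) (nth-ones (m≤n⇒m≤1+n ≤-refl))

  at-2a-1 : h (pos 2 3 0) ≡ 1
  at-2a-1 = h-at (2a-1-shape b) (nth-ones ≤-refl)

  at-2a : h (pos 2 4 0) ≡ 0
  at-2a = h-at (2a-shape b) (after-ones 0)

  at-2a+1 : h (pos 2 5 0) ≡ 2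
  at-2a+1 = twos 0 0 (s≤s z≤n)

  at-2a+1+k : ∀ {k} → k < b → h (pos 2 5 k) ≡ 2
  at-2a+1+k {k} k<b = twos 0 k (m<n⇒m<1+n k<b)

  at-2a+2+k : ∀ {k} → k < b → h (pos 2 6 k) ≡ 2
  at-2a+2+k {k} k<b = twos 1 k (s≤s k<b)

  at-3a-1 : h (pos 3 5 0) ≡ 2
  at-3a-1 = h-at (3a-1-shape b) (nth-twos ≤-refl)

  at-3a : h (pos 3 6 0) ≡ 1
  at-3a = h-at (3a-shape b) (after-twos 0)

  at-3a+1 : h (pos 3 7 0) ≡ 0
  at-3a+1 = h-at (3a+1-shape b) (after-twos 1)

  at-3a+2+k : ∀ {k} → k < b → h (pos 3 8 k) ≡ 3
  at-3a+2+k {k} k<b = h-at (threes-shape b k) (nth-threes k<b)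

  at-4a : h (pos 4 8 0) ≡ 2
  at-4a = h-at (4a-word-shape b) (after-threes 0)

  at-4a+1 : h (pos 4 9 0) ≡ 1
  at-4a+1 = h-at (4a+1-shape b) (after-threes 1)

  wrapped : ∀ c d {k v} → h (pos c d k) ≡ v → h (pos (4 + c) (10 + d) k) ≡ v
  wrapped c d {k} hv = begin
    h (pos (4 + c) (10 + d) k) ≡⟨ cong h (sym (shift 4 10 {c} {d} {k} (p-shape b))) ⟩
    h (p + pos c d k)          ≡⟨ cong h (+-comm p (pos c d k)) ⟩
    h (pos c d k + p)          ≡⟨ h-periodic (pos c d k) ⟩
    h (pos c d k)              ≡⟨ hv ⟩
    _                          ∎

  -- The fourteen kinds of residue modulo p, at positions in linear form; the
  -- runs are split where moves by a, 2a + 1 or 3a + 2 cross run boundaries.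
  data Residue : ℕ → Set where
    [k]      : ∀ {k} → k < b → Residue (pos 0 0 k)
    [a-2]    : Residue (pos 1 0 0)
    [a-1]    : Residue (pos 1 1 0)
    [a]      : Residue (pos 1 2 0)
    [a+1+k]  : ∀ {k} → k < b → Residue (pos 1 3 k)
    [2a-1]   : Residue (pos 2 3 0)
    [2a]     : Residue (pos 2 4 0)
    [2a+1]   : Residue (pos 2 5 0)
    [2a+2+k] : ∀ {k} → k < b → Residue (pos 2 6 k)
    [3a]     : Residue (pos 3 6 0)
    [3a+1]   : Residue (pos 3 7 0)
    [3a+2+k] : ∀ {k} → k < b → Residue (pos 3 8 k)
    [4a]     : Residue (pos 4 8 0)
    [4a+1]   : Residue (pos 4 9 0)

  point-step : ∀ c d {i} → pos c d 0 ≤ i → i ≡ pos c d 0 ⊎ pos c (suc d) 0 ≤ i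
  point-step c d {i} le with m≤n⇒m<n∨m≡n le
  ... | inj₁ lt = inj₂ (subst (_≤ i) (pos-next-shape b c d) lt)
  ... | inj₂ eq = inj₁ (sym eq)

  run-step : ∀ c d {i} → pos c d 0 ≤ i → (∃[ k ] k < b × i ≡ pos c d k) ⊎ pos (suc c) d 0 ≤ i
  run-step c d {i} le with i <? pos c d 0 + b
  ... | yes lt = inj₁ (i ∸ pos c d 0 , +-cancelˡ-< (pos c d 0) _ _ (subst (_< _) (sym back) lt)
                                     , trans (sym back) (pos-run-shape b c d _))
    where back = m+[n∸m]≡n le
  ... | no ¬lt = inj₂ (subst (_≤ i) (pos-skip-shape b c d) (≮⇒≥ ¬lt))

  point : ∀ c d {i} → Residue (pos c d 0) → (pos c (suc d) 0 ≤ i → Residue i) →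
          pos c d 0 ≤ i → Residue i
  point c d at-point next le with point-step c d le
  ... | inj₁ refl = at-point
  ... | inj₂ le′  = next le′

  run : ∀ c d {i} → (∀ {k} → k < b → Residue (pos c d k)) → (pos (suc c) d 0 ≤ i → Residue i) →
        pos c d 0 ≤ i → Residue i
  run c d inside next le with run-step c d le
  ... | inj₁ (k , k<b , refl) = inside k<b
  ... | inj₂ le′               = next le′

  residue : ∀ {i} → i < p → Residue i
  residue {i} i<p =
    run 0 0 [k] (point 1 0 [a-2] (point 1 1 [a-1] (point 1 2 [a] (run 1 3 [a+1+k]
    (point 2 3 [2a-1] (point 2 4 [2a] (point 2 5 [2a+1] (run 2 6 [2a+2+k]
    (point 3 6 [3a] (point 3 7 [3a+1] (run 3 8 [3a+2+k]
    (point 4 8 [4a] (point 4 9 [4a+1] beyond))))))))))))) z≤n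
    where
    beyond : pos 4 10 0 ≤ i → Residue i
    beyond le = contradiction (subst (_≤ i) (sym (p-shape b)) le) (<⇒≱ i<p)

  Recurrence : ℕ → Set
  Recurrence n = h n ≡ mex (moves h S n)

  a≤2a+1 : a ≤ 2 * a + 1
  a≤2a+1 = ≤-trans (m≤m+n a (a + 0)) (m≤m+n (2 * a) 1)

  2a+1≤3a+2 : 2 * a + 1 ≤ 3 * a + 2
  2a+1≤3a+2 = +-mono-≤ (*-monoˡ-≤ a {2} {3} (s≤s (s≤s z≤n))) (s≤s z≤n)

  moves-none : ∀ {n} → n < a → moves h S n ≡ []
  moves-none {n} n<a =
    trans (if-no (a ≤? n) (<⇒≱ n<a))
      (trans (if-no (2 * a + 1 ≤? n) (<⇒≱ n<2a+1)) (if-no (3 * a + 2 ≤? n) (<⇒≱ (<-≤-trans n<2a+1 2a+1≤3a+2))))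
    where n<2a+1 = <-≤-trans n<a a≤2a+1

  moves-one : ∀ {n} → a ≤ n → n < 2 * a + 1 → moves h S n ≡ h (n ∸ a) ∷ []
  moves-one {n} a≤n n<2a+1 =
    trans (if-yes (a ≤? n) a≤n) (cong (h (n ∸ a) ∷_)
      (trans (if-no (2 * a + 1 ≤? n) (<⇒≱ n<2a+1)) (if-no (3 * a + 2 ≤? n) (<⇒≱ (<-≤-trans n<2a+1 2a+1≤3a+2)))))

  moves-two : ∀ {n} → 2 * a + 1 ≤ n → n < 3 * a + 2 → moves h S n ≡ h (n ∸ a) ∷ h (n ∸ (2 * a + 1)) ∷ []
  moves-two {n} 2a+1≤n n<3a+2 =
    trans (if-yes (a ≤? n) (≤-trans a≤2a+1 2a+1≤n)) (cong (h (n ∸ a) ∷_)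
      (trans (if-yes (2 * a + 1 ≤? n) 2a+1≤n) (cong (h (n ∸ (2 * a + 1)) ∷_) (if-no (3 * a + 2 ≤? n) (<⇒≱ n<3a+2)))))

  moves-all : ∀ {n} → 3 * a + 2 ≤ n →
              moves h S n ≡ h (n ∸ a) ∷ h (n ∸ (2 * a + 1)) ∷ h (n ∸ (3 * a + 2)) ∷ []
  moves-all {n} 3a+2≤n =
    trans (if-yes (a ≤? n) (≤-trans a≤2a+1 2a+1≤n)) (cong (h (n ∸ a) ∷_)
      (trans (if-yes (2 * a + 1 ≤? n) 2a+1≤n) (cong (h (n ∸ (2 * a + 1)) ∷_) (if-yes (3 * a + 2 ≤? n) 3a+2≤n))))
    where 2a+1≤n = ≤-trans 2a+1≤3a+2 3a+2≤n

  same-row : ∀ c d e → pos c d 0 < pos c (suc (d + e)) 0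
  same-row c d e = +-monoˡ-< 0 (+-monoʳ-< (c * b) (s≤s (m≤m+n d e)))

  next-row : ∀ c d e {k} → k ≤ b → pos c d k < pos (suc c) (suc (d + e)) 0
  next-row c d e k≤b = ≤-<-trans (+-monoʳ-≤ (c * b + d) k≤b)
                         (subst (c * b + d + b <_) (next-row-shape b c d e) (m<m+n _ (s≤s z≤n)))

  init-none : ∀ n {v} → n < a → h n ≡ v → v ≡ 0 → Recurrence n
  init-none n n<a hv refl = trans hv (cong mex (sym (moves-none n<a)))

  init-one : ∀ c d {k v v₁} → pos (1 + c) (2 + d) k < pos 2 5 0 →
             h (pos (1 + c) (2 + d) k) ≡ v → h (pos c d k) ≡ v₁ → v ≡ mex (v₁ ∷ []) →
             Recurrence (pos (1 + c) (2 + d) k)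
  init-one c d {k} {v} {v₁} below hv hv₁ v≡ = begin
    h n                  ≡⟨ trans hv v≡ ⟩
    mex (v₁ ∷ [])        ≡⟨ cong (λ x → mex (x ∷ [])) (sym (trans (cong h (minus-sum a _ n-a)) hv₁)) ⟩
    mex (h (n ∸ a) ∷ []) ≡⟨ cong mex (sym (moves-one (le-sum a _ n-a) n<2a+1)) ⟩
    mex (moves h S n)    ∎
    where
    n = pos (1 + c) (2 + d) k
    n-a : a + pos c d k ≡ n
    n-a = shift 1 2 {c} {d} {k} (a-shape b)
    n<2a+1 : n < 2 * a + 1
    n<2a+1 = subst (n <_) (sym (2a+1-shape b)) below

  init-two : ∀ c d {k v v₁ v₂} → pos (2 + c) (5 + d) k < pos 3 8 0 →
             h (pos (2 + c) (5 + d) k) ≡ v → h (pos (1 + c) (3 + d) k) ≡ v₁ → h (pos c d k) ≡ v₂ →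
             v ≡ mex (v₁ ∷ v₂ ∷ []) → Recurrence (pos (2 + c) (5 + d) k)
  init-two c d {k} {v} {v₁} {v₂} below hv hv₁ hv₂ v≡ = begin
    h n                                        ≡⟨ trans hv v≡ ⟩
    mex (v₁ ∷ v₂ ∷ [])                         ≡⟨ cong mex (sym (cong₂ (λ x y → x ∷ y ∷ []) option₁ option₂)) ⟩
    mex (h (n ∸ a) ∷ h (n ∸ (2 * a + 1)) ∷ []) ≡⟨ cong mex (sym (moves-two (le-sum (2 * a + 1) _ n-2a-1) n<3a+2)) ⟩
    mex (moves h S n)                          ∎
    where
    n = pos (2 + c) (5 + d) k
    n-a : a + pos (1 + c) (3 + d) k ≡ n
    n-a = shift 1 2 {1 + c} {3 + d} {k} (a-shape b)
    n-2a-1 : 2 * a + 1 + pos c d k ≡ n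
    n-2a-1 = shift 2 5 {c} {d} {k} (2a+1-shape b)
    option₁ : h (n ∸ a) ≡ v₁
    option₁ = trans (cong h (minus-sum a _ n-a)) hv₁
    option₂ : h (n ∸ (2 * a + 1)) ≡ v₂
    option₂ = trans (cong h (minus-sum (2 * a + 1) _ n-2a-1)) hv₂
    n<3a+2 : n < 3 * a + 2
    n<3a+2 = subst (n <_) (sym (3a+2-shape b)) below

  beyond-3a+2 : ∀ c d k → 3 * a + 2 ≤ pos (3 + c) (8 + d) k
  beyond-3a+2 c d k = subst (_≤ pos (3 + c) (8 + d) k) (sym (3a+2-shape b)) (le-sum (pos 3 8 0) (pos c d k) (pos-add 3 8 c d k))

  initial : ∀ {n} → Residue n → n < 3 * a + 2 → Recurrence n
  initial ([k] {k} k<b) _ = init-none k (k<a k<b) (at-k k<b) refl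
  initial [a-2]        _ = init-none (pos 1 0 0) (subst (pos 1 0 0 <_) (sym (a-shape b)) (same-row 1 0 1)) at-a-2 refl
  initial [a-1]        _ = init-none (pos 1 1 0) (subst (pos 1 1 0 <_) (sym (a-shape b)) (same-row 1 1 0)) at-a-1 refl
  initial [a]          _ = init-one 0 0 (next-row 1 2 2 z≤n) at-a at-0 refl
  initial ([a+1+k] k<b) _ = init-one 0 1 (next-row 1 3 1 (<⇒≤ k<b)) (at-a+1+k k<b) (at-1+k k<b) refl
  initial [2a-1]       _ = init-one 1 1 (same-row 2 3 1) at-2a-1 at-a-1 refl
  initial [2a]         _ = init-one 1 2 (same-row 2 4 0) at-2a at-a refl
  initial [2a+1]       _ = init-two 0 0 (next-row 2 5 2 z≤n) at-2a+1 at-a+1 at-0 refl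
  initial ([2a+2+k] k<b) _ =
    init-two 0 1 (next-row 2 6 1 (<⇒≤ k<b)) (at-2a+2+k k<b) (at-a+2+k k<b) (at-1+k k<b) refl
  initial [3a]         _ = init-two 1 1 (same-row 3 6 1) at-3a at-2a at-a-1 refl
  initial [3a+1]       _ = init-two 1 2 (same-row 3 7 0) at-3a+1 at-2a+1 at-a refl
  initial ([3a+2+k] {k} _) n<3a+2 = contradiction (beyond-3a+2 0 0 k) (<⇒≱ n<3a+2)
  initial [4a]         n<3a+2 = contradiction (beyond-3a+2 1 0 0) (<⇒≱ n<3a+2)
  initial [4a+1]       n<3a+2 = contradiction (beyond-3a+2 1 1 0) (<⇒≱ n<3a+2)

  -- From 3a + 2 on all moves exist, and by periodicity the recurrence at n is a
  -- statement about the residue n mod p, read cyclically.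
  Cyclic : ℕ → Set
  Cyclic i = h i ≡ mex (h (3 * a + 2 + i) ∷ h (2 * a + 1 + i) ∷ h (a + i) ∷ [])

  cyc-case : ∀ c d {k v v₁ v₂ v₃} →
             h (pos c d k) ≡ v → h (pos (3 + c) (8 + d) k) ≡ v₁ → h (pos (2 + c) (5 + d) k) ≡ v₂ →
             h (pos (1 + c) (2 + d) k) ≡ v₃ → v ≡ mex (v₁ ∷ v₂ ∷ v₃ ∷ []) → Cyclic (pos c d k)
  cyc-case c d {k} {v} {v₁} {v₂} {v₃} hv hv₁ hv₂ hv₃ v≡ = begin
    h i                                                          ≡⟨ trans hv v≡ ⟩
    mex (v₁ ∷ v₂ ∷ v₃ ∷ [])                                      ≡⟨ cong mex (sym option-values) ⟩
    mex (h (3 * a + 2 + i) ∷ h (2 * a + 1 + i) ∷ h (a + i) ∷ []) ∎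
    where
    i = pos c d k
    option : ∀ {x v′} c′ d′ → x ≡ pos c′ d′ 0 → h (pos (c′ + c) (d′ + d) k) ≡ v′ → h (x + i) ≡ v′
    option c′ d′ x≡ hv′ = trans (cong h (shift c′ d′ x≡)) hv′
    option-values : h (3 * a + 2 + i) ∷ h (2 * a + 1 + i) ∷ h (a + i) ∷ [] ≡ v₁ ∷ v₂ ∷ v₃ ∷ []
    option-values = cong₂ _∷_ (option 3 8 (3a+2-shape b) hv₁)
                (cong₂ _∷_ (option 2 5 (2a+1-shape b) hv₂) (cong (_∷ []) (option 1 2 (a-shape b) hv₃)))

  cyclic : ∀ {i} → Residue i → Cyclic i
  cyclic ([k] k<b) = cyc-case 0 0 (at-k k<b) (at-3a+2+k k<b) (at-2a+1+k k<b) (at-a+k k<b) refl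
  cyclic [a-2]   = cyc-case 1 0 at-a-2 at-4a at-3a-1 at-2a-2 refl
  cyclic [a-1]   = cyc-case 1 1 at-a-1 at-4a+1 at-3a at-2a-1 refl
  cyclic [a]     = cyc-case 1 2 at-a (wrapped 0 0 at-0) at-3a+1 at-2a refl
  cyclic ([a+1+k] k<b) =
    cyc-case 1 3 (at-a+1+k k<b) (wrapped 0 1 (at-1+k k<b)) (at-3a+2+k k<b) (at-2a+1+k k<b) refl
  cyclic [2a-1]  = cyc-case 2 3 at-2a-1 (wrapped 1 1 at-a-1) at-4a at-3a-1 refl
  cyclic [2a]    = cyc-case 2 4 at-2a (wrapped 1 2 at-a) at-4a+1 at-3a refl
  cyclic [2a+1]  = cyc-case 2 5 at-2a+1 (wrapped 1 3 at-a+1) (wrapped 0 0 at-0) at-3a+1 refl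
  cyclic ([2a+2+k] k<b) =
    cyc-case 2 6 (at-2a+2+k k<b) (wrapped 1 4 (at-a+2+k k<b)) (wrapped 0 1 (at-1+k k<b)) (at-3a+2+k k<b) refl
  cyclic [3a]    = cyc-case 3 6 at-3a (wrapped 2 4 at-2a) (wrapped 1 1 at-a-1) at-4a refl
  cyclic [3a+1]  = cyc-case 3 7 at-3a+1 (wrapped 2 5 at-2a+1) (wrapped 1 2 at-a) at-4a+1 refl
  cyclic ([3a+2+k] k<b) =
    cyc-case 3 8 (at-3a+2+k k<b) (wrapped 2 6 (at-2a+2+k k<b)) (wrapped 1 3 (at-a+1+k k<b)) (wrapped 0 0 (at-k k<b)) refl
  cyclic [4a]    = cyc-case 4 8 at-4a (wrapped 3 6 at-3a) (wrapped 2 3 at-2a-1) (wrapped 1 0 at-a-2) refl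
  cyclic [4a+1]  = cyc-case 4 9 at-4a+1 (wrapped 3 7 at-3a+1) (wrapped 2 4 at-2a) (wrapped 1 1 at-a-1) refl

  h-back : ∀ {s t n} → s ≤ n → s + t ≡ p → h (n ∸ s) ≡ h (t + n % p)
  h-back {s} {t} {n} s≤n s+t≡p = begin
    h (n ∸ s)                     ≡⟨ sym (h-periodic (n ∸ s)) ⟩
    h (n ∸ s + p)                 ≡⟨ cong h unwind ⟩
    h (t + n % p + (n / p) * p)   ≡⟨ h-multiple (t + n % p) (n / p) ⟩
    h (t + n % p)                 ∎
    where
    unwind : n ∸ s + p ≡ t + n % p + (n / p) * p
    unwind = begin
      n ∸ s + p                 ≡⟨ cong (n ∸ s +_) (sym s+t≡p) ⟩
      n ∸ s + (s + t)           ≡⟨ sym (+-assoc (n ∸ s) s t) ⟩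
      n ∸ s + s + t             ≡⟨ cong (_+ t) (m∸n+n≡m s≤n) ⟩
      n + t                     ≡⟨ +-comm n t ⟩
      t + n                     ≡⟨ cong (t +_) (m≡m%n+[m/n]*n n p) ⟩
      t + (n % p + (n / p) * p) ≡⟨ sym (+-assoc t (n % p) _) ⟩
      t + n % p + (n / p) * p   ∎

  full : ∀ {n} → 3 * a + 2 ≤ n → Recurrence n
  full {n} 3a+2≤n = begin
    h n                                                               ≡⟨ sym (h-mod n) ⟩
    h i                                                               ≡⟨ cyclic (residue (m%n<n n p)) ⟩
    mex (h (3 * a + 2 + i) ∷ h (2 * a + 1 + i) ∷ h (a + i) ∷ [])      ≡⟨ cong mex (sym option-values) ⟩
    mex (h (n ∸ a) ∷ h (n ∸ (2 * a + 1)) ∷ h (n ∸ (3 * a + 2)) ∷ []) ≡⟨ cong mex (sym (moves-all 3a+2≤n)) ⟩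
    mex (moves h S n)                                                 ∎
    where
    i = n % p
    2a+1≤n = ≤-trans 2a+1≤3a+2 3a+2≤n
    a≤n = ≤-trans a≤2a+1 2a+1≤n
    option-values : h (n ∸ a) ∷ h (n ∸ (2 * a + 1)) ∷ h (n ∸ (3 * a + 2)) ∷ []
            ≡ h (3 * a + 2 + i) ∷ h (2 * a + 1 + i) ∷ h (a + i) ∷ []
    option-values = cong₂ _∷_ (h-back a≤n (a+[3a+2] a))
                (cong₂ _∷_ (h-back 2a+1≤n ([2a+1]+[2a+1] a)) (cong (_∷ []) (h-back 3a+2≤n ([3a+2]+a a))))

  recurrence : ∀ n → Recurrence n
  recurrence n with 3 * a + 2 ≤? n
  ... | yes 3a+2≤n = full 3a+2≤n
  ... | no  3a+2≰n = initial (residue (<-≤-trans n<3a+2 (le-sum (3 * a + 2) a ([3a+2]+a a)))) n<3a+2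
    where n<3a+2 = ≰⇒> 3a+2≰n

  G≡h : ∀ n → G S n ≡ h n
  G≡h = G-unique S h recurrence

  G-periodic : ∀ n → G S (n + p) ≡ G S n
  G-periodic n = trans (G≡h (n + p)) (trans (h-periodic n) (sym (G≡h n)))

  differ : ∀ c′ d′ c d {k u v} → h (pos c′ d′ 0) ≡ u → h (pos (c′ + c) (d′ + d) k) ≡ v → u ≢ v →
           ∃[ n ] h (n + pos c d k) ≢ h n
  differ c′ d′ c d {k} hu hv u≢v =
    pos c′ d′ 0 , λ same → u≢v (trans (sym hu) (trans (sym same) (trans (cong h (pos-add c′ d′ c d k)) hv)))

  -- Since h 0 = 0, a residue with a nonzero value is witnessed by n = 0.
  nonzero : ∀ c d {k v} → h (pos c d k) ≡ suc v → ∃[ n ] h (n + pos c d k) ≢ h n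
  nonzero c d hv = differ 0 0 c d at-0 hv (λ ())

  not-a-period : ∀ {q} → Residue q → 1 ≤ q → ∃[ n ] h (n + q) ≢ h n
  not-a-period ([k] {k} k<b) 1≤k = shift-in-zeros k<b 1≤k
    where
    -- 1 ≤ k < a - 2: from 2a (value 0) a shift by k reaches the twos
    shift-in-zeros : ∀ {k} → k < b → 1 ≤ k → ∃[ n ] h (n + pos 0 0 k) ≢ h n
    shift-in-zeros {suc k} k<b _ =
      differ 2 4 0 0 at-2a (trans (cong h (pos-suc-shape b 2 4 k)) (at-2a+1+k (<-trans (n<1+n k) k<b))) (λ ())
  -- q = a - 2 ≥ 1 forces a ≥ 3, so position 2 is still in the first run.
  not-a-period [a-2] 1≤q =
    differ 0 2 1 0 (zeros 2 0 (+-monoʳ-< 2 (subst (1 ≤_) (a-2-shape b) 1≤q))) at-a (λ ())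
  not-a-period [a-1]    _ = differ 2 4 1 1 at-2a at-3a-1 (λ ())
  not-a-period [a]      _ = nonzero 1 2 at-a
  not-a-period ([a+1+k] k<b) _ = nonzero 1 3 (at-a+1+k k<b)
  not-a-period [2a-1]   _ = nonzero 2 3 at-2a-1
  not-a-period [2a]     _ = differ 1 1 2 4 at-a-1 at-3a-1 (λ ())
  not-a-period [2a+1]   _ = nonzero 2 5 at-2a+1
  not-a-period ([2a+2+k] k<b) _ = nonzero 2 6 (at-2a+2+k k<b)
  not-a-period [3a]     _ = nonzero 3 6 at-3a
  not-a-period [3a+1]   _ = differ 1 1 3 7 at-a-1 at-4a (λ ())
  not-a-period ([3a+2+k] k<b) _ = nonzero 3 8 (at-3a+2+k k<b)
  not-a-period [4a]     _ = nonzero 4 8 at-4a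
  not-a-period [4a+1]   _ = nonzero 4 9 at-4a+1

  least-period : ∀ q → 1 ≤ q → (∀ n → G S (n + q) ≡ G S n) → p ≤ q
  least-period q 1≤q period with p ≤? q
  ... | yes p≤q = p≤q
  ... | no  p≰q with not-a-period (residue (≰⇒> p≰q)) 1≤q
  ...   | n , changes = contradiction (trans (sym (G≡h (n + q))) (trans (period n) (G≡h n))) changes

  nim-sequence : PeriodicWith S p (word a)
  nim-sequence = record
    { period    = G-periodic
    ; least     = least-period
    ; wordLen   = length-word
    ; wordValue = λ n → trans (nth-at (word a) (subst (n % p <_) (sym length-word) (m%n<n n p)))
                              (cong just (sym (G≡h n)))
    }

  clash : ∀ c′ d′ c d {k v} → h (pos c′ d′ 0) ≡ v → h (pos (c′ + c) (d′ + d) k) ≡ v →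
          ¬ (∀ n → h (n + pos c d k) ≢ h n)
  clash c′ d′ c d {k} hu hv changes =
    changes (pos c′ d′ 0) (trans (cong h (pos-add c′ d′ c d k)) (trans hv (sym hu)))

  expansion-residue : ∀ {r} → Residue r → (∀ n → h (n + r) ≢ h n) → r ∈ S
  expansion-residue ([k] k<b) changes = ⊥-elim (clash 0 0 0 0 at-0 (at-k k<b) changes)
  expansion-residue [a-2]  changes = ⊥-elim (clash 0 0 1 0 at-0 at-a-2 changes)
  expansion-residue [a-1]  changes = ⊥-elim (clash 0 0 1 1 at-0 at-a-1 changes)
  expansion-residue [a]    _       = here (sym (a-shape b))
  expansion-residue ([a+1+k] k<b) changes = ⊥-elim (clash 3 7 1 3 at-3a+1 (wrapped 0 0 (at-k k<b)) changes)
  expansion-residue [2a-1] changes = ⊥-elim (clash 3 7 2 3 at-3a+1 (wrapped 1 0 at-a-2) changes)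
  expansion-residue [2a]   changes = ⊥-elim (clash 0 0 2 4 at-0 at-2a changes)
  expansion-residue [2a+1] _       = there (here (sym (2a+1-shape b)))
  expansion-residue ([2a+2+k] k<b) changes = ⊥-elim (clash 2 4 2 6 at-2a (wrapped 0 0 (at-k k<b)) changes)
  expansion-residue [3a]   changes = ⊥-elim (clash 2 4 3 6 at-2a (wrapped 1 0 at-a-2) changes)
  expansion-residue [3a+1] changes = ⊥-elim (clash 0 0 3 7 at-0 at-3a+1 changes)
  expansion-residue ([3a+2+k] {zero} _) _ = there (there (here (sym (3a+2-shape b))))
  expansion-residue ([3a+2+k] {suc k} k<b) changes =
    ⊥-elim (clash 1 1 3 8 at-a-1 (trans (cong h (pos-suc-shape b 4 9 k))
                                        (wrapped 0 0 (at-k (<-trans (n<1+n k) k<b)))) changes)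
  -- For a = 2 the residue 4a is the move size 3a + 2; otherwise position 2 is a 0.
  expansion-residue [4a] changes with b ≟ 0
  ... | yes b≡0 = there (there (here (trans (4a-shape b) (trans (cong (3 * a + 2 +_) b≡0) (+-identityʳ _)))))
  ... | no  b≢0 = ⊥-elim (clash 0 2 4 8 (zeros 2 0 (+-monoʳ-< 2 (n≢0⇒n>0 b≢0))) (wrapped 0 0 at-0) changes)
  expansion-residue [4a+1] changes = ⊥-elim (clash 1 1 4 9 at-a-1 (wrapped 1 0 at-a-2) changes)

  S-positive : ∀ {x} → x ∈ S → 1 ≤ x
  S-positive (here refl)                 = s≤s z≤n
  S-positive (there (here refl))         = s≤s z≤n
  S-positive (there (there (here refl))) = s≤s z≤n

  -- S^ex ⊆ S^{*p}: the residue of an element of S^ex lies in S.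
  expansion→star : ∀ s → InExpansion S s → InStar S p s
  expansion→star s (_ , changes) =
    s % p , s / p , expansion-residue (residue (m%n<n s p)) changes-residue , m≡m%n+[m/n]*n s p
    where
    changes-residue : ∀ n → h (n + s % p) ≢ h n
    changes-residue n same = changes n (begin
      G S (n + s)                   ≡⟨ cong (λ x → G S (n + x)) (m≡m%n+[m/n]*n s p) ⟩
      G S (n + (s % p + s / p * p)) ≡⟨ periodic-shift (G S) p G-periodic n (s % p) (s / p) ⟩
      G S (n + s % p)               ≡⟨ G≡h (n + s % p) ⟩
      h (n + s % p)                 ≡⟨ same ⟩
      h n                           ≡⟨ sym (G≡h n) ⟩
      G S n                         ∎)

  -- S^{*p} ⊆ S^ex: x + m·p acts like the move size x on the periodic G.
  star→expansion : ∀ s → InStar S p s → InExpansion S s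
  star→expansion _ (x , m , x∈S , refl) =
    ≤-trans (S-positive x∈S) (m≤m+n x (m * p)) ,
    λ n same → move-changes-G S x∈S (S-positive x∈S) n
                 (trans (sym (periodic-shift (G S) p G-periodic n x m)) same)

  expansion : ∀ s → InExpansion S s ⇔ InStar S p s
  expansion s = mk⇔ (expansion→star s) (star→expansion s)

theorem6p2 : (a : ℕ) → 2 ≤ a →
    PeriodicWith (a ∷ (2 * a + 1) ∷ (3 * a + 2) ∷ []) (2 + 4 * a) (word a)
    × NonExpandable (a ∷ (2 * a + 1) ∷ (3 * a + 2) ∷ []) (2 + 4 * a)
theorem6p2 (suc zero) (s≤s ())
theorem6p2 (suc (suc b)) _ = nim-sequence , inj₂ expansion
  where open Game b
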